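{- Let $p$ be a polynomial. Then there is a polynomial $q$ such that for every implicational formula $\rho$ and every normal tree-like $\textsc{NM}_{\rightarrow}$-proof $\partial$ of $\rho$ with $h(\partial)\le p(|\rho|)$ we have $h(\partial)+\phi(\partial)\le q(|\rho|)$. In words: any normal tree-like $\textsc{NM}_{\rightarrow}$-proof of $\rho$ whose height is polynomial in $|\rho|$ is quasi-polynomial.
   Context: Formulas are built from propositional variables using only $\rightarrow$; $|\alpha|$ denotes the weight (total number of symbols) of a formula $\alpha$. $\textsc{NM}_{\rightarrow}$ is natural deduction for minimal purely implicational logic with the rules: $(\rightarrow I)$ from $\beta$ infer $\alpha\rightarrow\beta$, where all $\alpha$-leaves above the premise $\beta$ are considered discharged assumptions; $(\rightarrow E)$ (modus ponens) from $\alpha$ and $\alpha\rightarrow\beta$ infer $\beta$ (here $\alpha\rightarrow\beta$ is the major premise); and the repetition rule $(R)$ from $\alpha$ infer $\alpha$. A tree-like deduction is a finite rooted tree whose nodes are labeled by formulas, leaves being assumptions and each inner node being the conclusion of one of these rules with its children as premises. A maximal thread is a path from the root to a leaf; a thread from the root to a leaf labeled $\alpha$ is closed if it contains an $(\rightarrow I)$ inference with conclusion $\alpha\rightarrow\beta$ (for some $\beta$) discharging $\alpha$. A deduction $\partial$ with root labeled $\rho$ proves $\rho$ (is a proof of $\rho$) if every maximal thread is closed. $\partial$ is normal if it contains no formula occurrence that is both the conclusion of an $(\rightarrow I)$ (possibly followed by repetitions $(R)$) and the major premise of an $(\rightarrow E)$. $h(\partial)$ is the height of $\partial$, $\phi(\partial)$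 is the total weight of the distinct formulas occurring in $\partial$ (each distinct formula counted once), and $\partial$ is called quasi-polynomial if $h(\partial)+\phi(\partial)$ is polynomial in $|\rho|$. -}

module Defs where

open import Data.Nat using (ℕ; zero; suc; _+_; _*_; _⊔_)
open import Data.Nat.Properties using () renaming (_≟_ to _≟ℕ_)
open import Data.List using (List; []; _∷_; _++_; deduplicate; map)
open import Data.Nat.ListAction using (sum)
open import Data.List.Membership.Propositional using (_∈_)
open import Data.Product using (_×_; _,_)
open import Data.Unit using (⊤)
open import Data.Empty using (⊥)
open import Relation.Nullary using (¬_; Dec; yes; no)
open import Relation.Binary.PropositionalEquality using (_≡_; refl; cong)

infixr 6 _⇒_
data Fm : Set where
  var : ℕ → Fm
  _⇒_ : Fm → Fm → Fm

∣_∣ : Fm → ℕ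
∣ var _ ∣ = 1
∣ α ⇒ β ∣ = suc (∣ α ∣ + ∣ β ∣)

_≟_ : (α β : Fm) → Dec (α ≡ β)
var m ≟ var n with m ≟ℕ n
... | yes refl = yes refl
... | no m≢n = no λ { refl → m≢n refl }
var _ ≟ (_ ⇒ _) = no λ ()
(_ ⇒ _) ≟ var _ = no λ ()
(α ⇒ β) ≟ (γ ⇒ δ) with α ≟ γ | β ≟ δ
... | yes refl | yes refl = yes refl
... | no a≢c | _ = no λ { refl → a≢c refl }
... | yes _ | no b≢d = no λ { refl → b≢d refl }

-- Tree-like NM→ deductions, indexed by the formula labelling the root.
-- Every node is labelled by a formula (the index of its subtree).

data Ded : Fm → Set where
  assm : (α : Fm) → Ded α
  -- (→I): from β infer α → β (discharging α-leaves above)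
  ⇒I   : (α : Fm) {β : Fm} → Ded β → Ded (α ⇒ β)
  -- (→E): from α (minor) and α → β (major) infer β
  ⇒E   : {α β : Fm} → Ded α → Ded (α ⇒ β) → Ded β
  rep  : {α : Fm} → Ded α → Ded α

-- Every maximal thread (root-to-leaf path) is closed: the leaf label α
-- is the antecedent of some (→I) conclusion α → β on the path.
-- Γ collects the antecedents of (→I) inferences seen on the path so far.
AllThreadsClosed : {ρ : Fm} → List Fm → Ded ρ → Set
AllThreadsClosed Γ (assm α) = α ∈ Γ
AllThreadsClosed Γ (⇒I α d) = AllThreadsClosed (α ∷ Γ) d
AllThreadsClosed Γ (⇒E d e) = AllThreadsClosed Γ d × AllThreadsClosed Γ e
AllThreadsClosed Γ (rep d)  = AllThreadsClosed Γ d

IsProof : {ρ : Fm} → Ded ρ → Set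
IsProof d = AllThreadsClosed [] d

IntroThenReps : {α : Fm} → Ded α → Set
IntroThenReps (assm _)  = ⊥
IntroThenReps (⇒I _ _)  = ⊤
IntroThenReps (⇒E _ _)  = ⊥
IntroThenReps (rep d)   = IntroThenReps d

Normal : {α : Fm} → Ded α → Set
Normal (assm _)  = ⊤
Normal (⇒I _ d)  = Normal d
Normal (⇒E d e)  = Normal d × Normal e × ¬ IntroThenReps e
Normal (rep d)   = Normal d

height : {α : Fm} → Ded α → ℕ
height (assm _)  = 0
height (⇒I _ d)  = suc (height d)
height (⇒E d e)  = suc (height d ⊔ height e)
height (rep d)   = suc (height d)

labels : {α : Fm} → Ded α → List Fm
labels {α} (assm _)  = α ∷ []
labels {α} (⇒I _ d)  = α ∷ labels d
labels {α} (⇒E d e)  = α ∷ labels d ++ labels e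
labels {α} (rep d)   = α ∷ labels d

φ : {α : Fm} → Ded α → ℕ
φ d = sum (map ∣_∣ (deduplicate _≟_ (labels d)))

-- Polynomials in one variable with natural-number coefficients,
-- given by coefficient lists c₀ ∷ c₁ ∷ … (lowest degree first).

Poly : Set
Poly = List ℕ

eval : Poly → ℕ → ℕ
eval []       x = 0
eval (c ∷ cs) x = c + x * eval cs x

{-# OPTIONS --safe #-}
-- In a normal deduction every formula occurrence is a subformula of the root or of an
-- undischarged assumption: following major premises upwards from the conclusion of an
-- elimination leads to an assumption, whose label contains that major premise as a
-- subformula. For a proof there are no undischarged assumptions, so all labels lie among
-- the at most |ρ| subformulas of ρ, each of weight at most |ρ|. Hence φ(∂) ≤ |ρ|², and
-- h(∂) + φ(∂) ≤ p(|ρ|) + |ρ|².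
module Submission where

open import Defs
open import Data.Nat using (ℕ; suc; _+_; _*_; _≤_; z≤n; s≤s)
open import Data.Nat.Properties
  using (≤-refl; ≤-trans; +-mono-≤; *-monoˡ-≤; m≤m+n; m≤n+m; n≤1+n; +-suc; +-identityʳ; *-zeroʳ; *-identityʳ;
         module ≤-Reasoning)
open import Data.Nat.Tactic.RingSolver using (solve-∀)
open import Data.Nat.ListAction using (sum)
open import Data.List using (List; []; _∷_; _++_; deduplicate; map; length)
open import Data.List.Properties using (length-++)
open import Data.List.Relation.Unary.Any as Any using (Any; here; there)
import Data.List.Relation.Unary.All as All
open import Data.List.Relation.Unary.AllPairs using (_∷_)
open import Data.List.Relation.Unary.Unique.Propositional using (Unique)
open import Data.List.Relation.Unary.Unique.DecPropositional.Properties using (deduplicate-!)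
open import Data.List.Relation.Binary.Subset.Propositional using (_⊆_)
open import Data.List.Membership.Propositional using (_∈_)
open import Data.List.Membership.Propositional.Properties
  using (∈-++⁺ˡ; ∈-++⁺ʳ; ∈-++⁻; ∈-∃++; ∈-deduplicate⁻)
open import Data.Product using (Σ; _,_)
open import Data.Sum using (_⊎_; inj₁; inj₂; [_,_])
open import Data.Empty using (⊥-elim)
open import Data.Unit using (tt)
open import Function using (_∘_)
open import Relation.Nullary using (¬_)
open import Relation.Binary.PropositionalEquality using (_≡_; _≢_; refl; sym; cong)

module _ {a} {A : Set a} where

  ∈-++-∷⁻ : ∀ {x y} (ys zs : List A) → y ∈ ys ++ x ∷ zs → y ≢ x → y ∈ ys ++ zs
  ∈-++-∷⁻ ys zs y∈ y≢x with ∈-++⁻ ys y∈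
  ... | inj₁ y∈ys          = ∈-++⁺ˡ y∈ys
  ... | inj₂ (here y≡x)    = ⊥-elim (y≢x y≡x)
  ... | inj₂ (there y∈zs)  = ∈-++⁺ʳ ys y∈zs

  Unique-⊆⇒length-≤ : ∀ {xs ys : List A} → Unique xs → xs ⊆ ys → length xs ≤ length ys
  Unique-⊆⇒length-≤ {[]}     _ _ = z≤n
  Unique-⊆⇒length-≤ {x ∷ xs} (x∉xs ∷ xs!) xs⊆ys
    with ys₁ , ys₂ , refl ← ∈-∃++ (xs⊆ys (here refl)) = begin
      suc (length xs)               ≤⟨ s≤s (Unique-⊆⇒length-≤ xs! xs⊆ys₁++ys₂) ⟩
      suc (length (ys₁ ++ ys₂))     ≡⟨ cong suc (length-++ ys₁) ⟩
      suc (length ys₁ + length ys₂) ≡⟨ sym (+-suc (length ys₁) (length ys₂)) ⟩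
      length ys₁ + length (x ∷ ys₂) ≡⟨ sym (length-++ ys₁) ⟩
      length (ys₁ ++ x ∷ ys₂)       ∎
    where
    open ≤-Reasoning
    xs⊆ys₁++ys₂ : xs ⊆ ys₁ ++ ys₂
    xs⊆ys₁++ys₂ y∈xs = ∈-++-∷⁻ ys₁ ys₂ (xs⊆ys (there y∈xs)) (All.lookup x∉xs y∈xs ∘ sym)

  sum-map-≤-length-* : ∀ (f : A → ℕ) {k} (xs : List A) →
                        (∀ {x} → x ∈ xs → f x ≤ k) → sum (map f xs) ≤ length xs * k
  sum-map-≤-length-* f []       _   = z≤n
  sum-map-≤-length-* f (x ∷ xs) f≤k = +-mono-≤ (f≤k (here refl)) (sum-map-≤-length-* f xs (f≤k ∘ there))

infix 4 _⊑_ _⊑*_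

data _⊑_ : Fm → Fm → Set where
  ⊑-refl : ∀ {γ} → γ ⊑ γ
  ⊑-⇒ˡ   : ∀ {γ α β} → γ ⊑ α → γ ⊑ α ⇒ β
  ⊑-⇒ʳ   : ∀ {γ α β} → γ ⊑ β → γ ⊑ α ⇒ β

⊑-trans : ∀ {γ δ ε} → γ ⊑ δ → δ ⊑ ε → γ ⊑ ε
⊑-trans γ⊑δ ⊑-refl      = γ⊑δ
⊑-trans γ⊑δ (⊑-⇒ˡ δ⊑α) = ⊑-⇒ˡ (⊑-trans γ⊑δ δ⊑α)
⊑-trans γ⊑δ (⊑-⇒ʳ δ⊑β) = ⊑-⇒ʳ (⊑-trans γ⊑δ δ⊑β)

⊑⇒∣∣≤ : ∀ {γ ρ} → γ ⊑ ρ → ∣ γ ∣ ≤ ∣ ρ ∣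
⊑⇒∣∣≤ ⊑-refl = ≤-refl
⊑⇒∣∣≤ {ρ = α ⇒ β} (⊑-⇒ˡ γ⊑α) = ≤-trans (⊑⇒∣∣≤ γ⊑α) (≤-trans (m≤m+n ∣ α ∣ ∣ β ∣) (n≤1+n _))
⊑⇒∣∣≤ {ρ = α ⇒ β} (⊑-⇒ʳ γ⊑β) = ≤-trans (⊑⇒∣∣≤ γ⊑β) (≤-trans (m≤n+m ∣ β ∣ ∣ α ∣) (n≤1+n _))

subformulas : Fm → List Fm
subformulas (var n) = var n ∷ []
subformulas (α ⇒ β) = α ⇒ β ∷ subformulas α ++ subformulas β

length-subformulas : ∀ ρ → length (subformulas ρ) ≤ ∣ ρ ∣
length-subformulas (var n) = ≤-refl
length-subformulas (α ⇒ β) rewrite length-++ (subformulas α) {subformulas β} =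
  s≤s (+-mono-≤ (length-subformulas α) (length-subformulas β))

⊑⇒∈-subformulas : ∀ {γ ρ} → γ ⊑ ρ → γ ∈ subformulas ρ
⊑⇒∈-subformulas {ρ = var n} ⊑-refl = here refl
⊑⇒∈-subformulas {ρ = α ⇒ β} ⊑-refl = here refl
⊑⇒∈-subformulas {ρ = α ⇒ β} (⊑-⇒ˡ γ⊑α) = there (∈-++⁺ˡ (⊑⇒∈-subformulas γ⊑α))
⊑⇒∈-subformulas {ρ = α ⇒ β} (⊑-⇒ʳ γ⊑β) = there (∈-++⁺ʳ (subformulas α) (⊑⇒∈-subformulas γ⊑β))

_⊑*_ : Fm → List Fm → Set
γ ⊑* Γ = Any (γ ⊑_) Γ

⊑-⊑*-trans : ∀ {γ δ Γ} → γ ⊑ δ → δ ⊑* Γ → γ ⊑* Γ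
⊑-⊑*-trans γ⊑δ = Any.map (⊑-trans γ⊑δ)

∈⇒⊑* : ∀ {γ Γ} → γ ∈ Γ → γ ⊑* Γ
∈⇒⊑* = Any.map λ { refl → ⊑-refl }

⊑⊎⊑*-trans : ∀ {γ δ Γ} → γ ⊑ δ ⊎ γ ⊑* Γ → δ ⊑* Γ → γ ⊑* Γ
⊑⊎⊑*-trans (inj₁ γ⊑δ)  δ⊑*Γ = ⊑-⊑*-trans γ⊑δ δ⊑*Γ
⊑⊎⊑*-trans (inj₂ γ⊑*Γ) _    = γ⊑*Γ

⊑⊎⊑*-discharge : ∀ {γ α β Γ} → γ ⊑ β ⊎ γ ⊑* α ∷ Γ → γ ⊑ α ⇒ β ⊎ γ ⊑* Γ
⊑⊎⊑*-discharge (inj₁ γ⊑β)           = inj₁ (⊑-⇒ʳ γ⊑β)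
⊑⊎⊑*-discharge (inj₂ (here γ⊑α))    = inj₁ (⊑-⇒ˡ γ⊑α)
⊑⊎⊑*-discharge (inj₂ (there γ⊑*Γ)) = inj₂ γ⊑*Γ

elim-conclusion-⊑* : ∀ {Γ α} (d : Ded α) → AllThreadsClosed Γ d → Normal d →
                     ¬ IntroThenReps d → α ⊑* Γ
elim-conclusion-⊑* (assm α) α∈Γ _ _  = ∈⇒⊑* α∈Γ
elim-conclusion-⊑* (⇒I α d) _   _ ¬I = ⊥-elim (¬I tt)
elim-conclusion-⊑* (⇒E d e) (_ , closed) (_ , normal , ¬Ie) _ =
  ⊑-⊑*-trans (⊑-⇒ʳ ⊑-refl) (elim-conclusion-⊑* e closed normal ¬Ie)
elim-conclusion-⊑* (rep d)  closed normal ¬I = elim-conclusion-⊑* d closed normal ¬I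

subformula-property : ∀ {Γ α γ} (d : Ded α) → AllThreadsClosed Γ d → Normal d →
                      γ ∈ labels d → γ ⊑ α ⊎ γ ⊑* Γ
subformula-property (assm α) _ _ (here refl) = inj₁ ⊑-refl
subformula-property (⇒I α d) _ _ (here refl) = inj₁ ⊑-refl
subformula-property (⇒I α d) closed normal (there γ∈) =
  ⊑⊎⊑*-discharge (subformula-property d closed normal γ∈)
subformula-property (⇒E d e) _ _ (here refl) = inj₁ ⊑-refl
subformula-property {Γ} (⇒E {α} {β} d e) (closed-d , closed-e) (normal-d , normal-e , ¬Ie) (there γ∈) =
  inj₂ ([ (λ γ∈d → ⊑⊎⊑*-trans (subformula-property d closed-d normal-d γ∈d) minor⊑*Γ)
        , (λ γ∈e → ⊑⊎⊑*-trans (subformula-property e closed-e normal-e γ∈e) major⊑*Γ)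
        ] (∈-++⁻ (labels d) γ∈))
  where
  major⊑*Γ : α ⇒ β ⊑* Γ
  major⊑*Γ = elim-conclusion-⊑* e closed-e normal-e ¬Ie
  minor⊑*Γ : α ⊑* Γ
  minor⊑*Γ = ⊑-⊑*-trans (⊑-⇒ˡ ⊑-refl) major⊑*Γ
subformula-property (rep d) _ _ (here refl) = inj₁ ⊑-refl
subformula-property (rep d) closed normal (there γ∈) = subformula-property d closed normal γ∈

normal-proof-labels-⊑ : ∀ {ρ γ} (d : Ded ρ) → IsProof d → Normal d → γ ∈ labels d → γ ⊑ ρ
normal-proof-labels-⊑ d closed normal γ∈ with subformula-property d closed normal γ∈
... | inj₁ γ⊑ρ = γ⊑ρ

φ-normal-proof-≤ : ∀ {ρ} (d : Ded ρ) → IsProof d → Normal d → φ d ≤ ∣ ρ ∣ * ∣ ρ ∣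
φ-normal-proof-≤ {ρ} d closed normal = begin
  sum (map ∣_∣ distinct)         ≤⟨ sum-map-≤-length-* ∣_∣ distinct (⊑⇒∣∣≤ ∘ distinct-⊑) ⟩
  length distinct * ∣ ρ ∣        ≤⟨ *-monoˡ-≤ ∣ ρ ∣ length-distinct-≤ ⟩
  ∣ ρ ∣ * ∣ ρ ∣                  ∎
  where
  open ≤-Reasoning
  distinct : List Fm
  distinct = deduplicate _≟_ (labels d)
  distinct-⊑ : ∀ {γ} → γ ∈ distinct → γ ⊑ ρ
  distinct-⊑ = normal-proof-labels-⊑ d closed normal ∘ ∈-deduplicate⁻ _≟_ (labels d)
  length-distinct-≤ : length distinct ≤ ∣ ρ ∣
  length-distinct-≤ = ≤-trans
    (Unique-⊆⇒length-≤ (deduplicate-! _≟_ (labels d)) (⊑⇒∈-subformulas ∘ distinct-⊑))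
    (length-subformulas ρ)

infixl 6 _+ᴾ_

_+ᴾ_ : Poly → Poly → Poly
[]       +ᴾ q        = q
(c ∷ cs) +ᴾ []       = c ∷ cs
(c ∷ cs) +ᴾ (d ∷ ds) = c + d ∷ cs +ᴾ ds

eval-+ᴾ : ∀ p q x → eval (p +ᴾ q) x ≡ eval p x + eval q x
eval-+ᴾ []       q        x = refl
eval-+ᴾ (c ∷ cs) []       x = sym (+-identityʳ _)
eval-+ᴾ (c ∷ cs) (d ∷ ds) x rewrite eval-+ᴾ cs ds x = distribute c d x (eval cs x) (eval ds x)
  where
  distribute : ∀ c d x a b → c + d + x * (a + b) ≡ (c + x * a) + (d + x * b)
  distribute = solve-∀

X² : Poly
X² = 0 ∷ 0 ∷ 1 ∷ []

eval-X² : ∀ x → eval X² x ≡ x * x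
eval-X² x rewrite *-zeroʳ x | *-identityʳ x = refl

lemma5 : (p : Poly) → Σ Poly (λ q → (ρ : Fm) (d : Ded ρ) → IsProof d → Normal d →
           height d ≤ eval p ∣ ρ ∣ → height d + φ d ≤ eval q ∣ ρ ∣)
lemma5 p = p +ᴾ X² , bound
  where
  bound : (ρ : Fm) (d : Ded ρ) → IsProof d → Normal d →
          height d ≤ eval p ∣ ρ ∣ → height d + φ d ≤ eval (p +ᴾ X²) ∣ ρ ∣
  bound ρ d closed normal h≤p
    rewrite eval-+ᴾ p X² ∣ ρ ∣ | eval-X² ∣ ρ ∣ = +-mono-≤ h≤p (φ-normal-proof-≤ d closed normal)
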